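{- Let $\mathcal{L}$ be a propositional language. The $\boldsymbol{\Sigma}_{\mathcal{L}}$-module $\mathbf{Mult}_{\mathcal{L}}$ is cyclic and onto-projective in the category of $\boldsymbol{\Sigma}_{\mathcal{L}}$-modules; in particular it has the representation property (REP).
   Context: $\mathbf{Fm}_{\mathcal{L}}$ is the algebra of $\mathcal{L}$-formulas over countably many variables; substitutions are its endomorphisms. For a set $X$, $X^\flat$ is the set of finite multisets over $X$ (functions $X\to\mathbb{N}$ with finite support), ordered by $\mathfrak{X}\leqslant\mathfrak{Y}$ iff $\mathfrak{X}(x)\leq\mathfrak{Y}(x)$ for all $x$, with multiset sum $\uplus$ (pointwise addition) and empty multiset $\emptyset$; maps $f$ extend to multisets by $f([a_1,\dots,a_n])=[f(a_1),\dots,f(a_n)]$. $\boldsymbol{\Sigma}_{\mathcal{L}}=\langle\mathrm{End}(\mathbf{Fm}_{\mathcal{L}})^\flat,\leqslant,\uplus,\cdot,\emptyset,[\mathrm{id}]\rangle$ where $[\sigma_1,\dots,\sigma_n]\cdot[\pi_1,\dots,\pi_m]=[\sigma_i\circ\pi_j: i\leq n, j\leq m]$ (a dually integral po-semiring). $\mathbf{Mult}_{\mathcal{L}}=\langle Fm_{\mathcal{L}}^\flat,\leqslant,\uplus,\emptyset,\ast\rangle$ with $[\sigma_1,\dots,\sigma_n]\ast\Gamma=\sigma_1(\Gamma)\uplus\dots\uplus\sigma_n(\Gamma)$. For a dually integral po-semiring $\mathbf{A}$ (structure $\langle A,\leq,+,\cdot,0,1\rangle$: $\langle A,\cdot,1\rangle$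 monoid, $\langle A,\leq,+,0\rangle$ commutative pomonoid with $0$ least, $0$ absorbing for $\cdot$, $\cdot$ distributing over $+$, $\cdot$ monotone in each argument by elements $\geq 0$), an $\mathbf{A}$-module is $\langle R,\leq,+,0,\ast\rangle$ with $\langle R,\leq,+,0\rangle$ a commutative pomonoid with least element $0$ and $\ast\colon A\times R\to R$ a monoid action with $0\ast a=0$, distributive over $+$ in both arguments, and monotone in each coordinate. Morphisms are order-preserving monoid homomorphisms commuting with $\ast$. A module $\boldsymbol{R}$ is cyclic if $R=\{\sigma\ast a:\sigma\in A\}$ for some $a\in R$; onto-projective if for all morphisms $f\colon\boldsymbol{S}\to\boldsymbol{T}$ surjective and $g\colon\boldsymbol{R}\to\boldsymbol{T}$ there is a morphism $h$ with $f\circ h=g$. A deductive operator (DO) on $\langle R,\leq,+,0\rangle$ is $\delta\colon R\to\wp(R)$ with $a\in\delta(a)$; $a\leq b\Rightarrow\delta(a)\subseteq\delta(b)$; $a\in\delta(b)\Rightarrow\delta(a)\subseteq\delta(b)$; $a\in\delta(b)\Rightarrow a+c\in\delta(b+c)$; it is action-invariant if $a\in\delta(b)\Rightarrow\sigma\ast a\in\delta(\sigma\ast b)$. $\boldsymbol{R}_\delta$ is the module with universe $\{\delta(a):a\in R\}$, order $\subseteq$, $\delta(a)+\delta(b)=\delta(a+b)$, zero $\delta(0)$, $\sigma\ast\delta(a)=\delta(\sigma\ast a)$. $\boldsymbol{R}$ has the REP if for every module $\boldsymbol{S}$, action-invariant DOs $\delta$ on $\boldsymbol{R}$, $\gamma$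 on $\boldsymbol{S}$, and every injective order-reflecting morphism $\Phi\colon\boldsymbol{R}_\delta\to\boldsymbol{S}_\gamma$, there is a morphism $\tau\colon\boldsymbol{R}\to\boldsymbol{S}$ with $\gamma\circ\tau=\Phi\circ\delta$. -}

module Defs where

open import Level using (Level; _⊔_) renaming (suc to lsuc)
open import Data.Nat using (ℕ)
open import Data.Product using (Σ; ∃; _×_; _,_; proj₁; proj₂)
open import Data.List using (List; []; _∷_; _++_; map; concatMap; cartesianProductWith)
open import Data.Vec as Vec using (Vec)
import Data.Vec.Properties as VecP
open import Function using (id; _∘_)
open import Relation.Binary using (Rel; Setoid; IsEquivalence; IsPreorder; IsPartialOrder)
open import Relation.Binary.PropositionalEquality as P using (_≡_)
open import Algebra.Structures using (IsMagma; IsSemigroup; IsMonoid; IsCommutativeMonoid)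
import Data.List.Relation.Binary.Permutation.Setoid as PermS
import Data.List.Relation.Binary.Permutation.Propositional as PermP

-- The operations of a (dually integral) po-semiring  ⟨A, ≤, +, ·, 0, 1⟩.
-- (The notion of A-module below only refers to these operations.)
record RawPoSemiring (a e o : Level) : Set (lsuc (a ⊔ e ⊔ o)) where
  infix  4 _≈_ _≤_
  infixl 6 _+_
  infixl 7 _·_
  field
    Carrier : Set a
    _≈_     : Rel Carrier e
    _≤_     : Rel Carrier o
    _+_     : Carrier → Carrier → Carrier
    _·_     : Carrier → Carrier → Carrier
    0#      : Carrier
    1#      : Carrier

module _ {a e o : Level} (A : RawPoSemiring a e o) where
  private module A = RawPoSemiring A

  record RawModule (r ℓ p : Level) : Set (lsuc (a ⊔ r ⊔ ℓ ⊔ p)) where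
    infix  4 _≈_ _≤_
    infixl 6 _+_
    infixr 7 _∗_
    field
      Carrier : Set r
      _≈_     : Rel Carrier ℓ
      _≤_     : Rel Carrier p
      _+_     : Carrier → Carrier → Carrier
      0#      : Carrier
      _∗_     : A.Carrier → Carrier → Carrier

  record IsModule {r ℓ p : Level} (M : RawModule r ℓ p) : Set (a ⊔ e ⊔ o ⊔ r ⊔ ℓ ⊔ p) where
    open RawModule M
    field
      isPartialOrder        : IsPartialOrder _≈_ _≤_
      +-isCommutativeMonoid : IsCommutativeMonoid _≈_ _+_ 0#
      +-mono     : ∀ {x y u v} → x ≤ y → u ≤ v → x + u ≤ y + v
      0-least    : ∀ x → 0# ≤ x
      ∗-cong     : ∀ {σ π x y} → σ A.≈ π → x ≈ y → σ ∗ x ≈ π ∗ y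
      ∗-identity : ∀ x → A.1# ∗ x ≈ x
      ∗-assoc    : ∀ σ π x → (σ A.· π) ∗ x ≈ σ ∗ (π ∗ x)
      ∗-zero     : ∀ x → A.0# ∗ x ≈ 0#
      ∗-distribˡ : ∀ σ x y → σ ∗ (x + y) ≈ σ ∗ x + σ ∗ y
      ∗-distribʳ : ∀ σ π x → (σ A.+ π) ∗ x ≈ σ ∗ x + π ∗ x
      ∗-mono     : ∀ {σ π x y} → σ A.≤ π → x ≤ y → σ ∗ x ≤ π ∗ y

  record Module (r ℓ p : Level) : Set (lsuc (a ⊔ e ⊔ o ⊔ r ⊔ ℓ ⊔ p)) where
    field
      raw      : RawModule r ℓ p
      isModule : IsModule raw
    open RawModule raw public
    open IsModule isModule public

  module _ {r₁ ℓ₁ p₁ r₂ ℓ₂ p₂ : Level}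
           (R : Module r₁ ℓ₁ p₁) (S : Module r₂ ℓ₂ p₂) where
    private
      module R = Module R
      module S = Module S

    record IsMorphism (f : R.Carrier → S.Carrier) : Set (a ⊔ r₁ ⊔ ℓ₁ ⊔ p₁ ⊔ ℓ₂ ⊔ p₂) where
      field
        cong  : ∀ {x y} → x R.≈ y → f x S.≈ f y
        mono  : ∀ {x y} → x R.≤ y → f x S.≤ f y
        +-hom : ∀ x y → f (x R.+ y) S.≈ f x S.+ f y
        0-hom : f R.0# S.≈ S.0#
        ∗-hom : ∀ σ x → f (σ R.∗ x) S.≈ σ S.∗ f x

    Surjective : (R.Carrier → S.Carrier) → Set (r₁ ⊔ r₂ ⊔ ℓ₂)
    Surjective f = ∀ y → ∃ λ x → f x S.≈ y

    Injective : (R.Carrier → S.Carrier) → Set (r₁ ⊔ ℓ₁ ⊔ ℓ₂)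
    Injective f = ∀ {x y} → f x S.≈ f y → x R.≈ y

    OrderReflecting : (R.Carrier → S.Carrier) → Set (r₁ ⊔ p₁ ⊔ p₂)
    OrderReflecting f = ∀ {x y} → f x S.≤ f y → x R.≤ y

  module _ {r ℓ p : Level} (R : Module r ℓ p) where
    private module R = Module R

    Cyclic : Set (a ⊔ r ⊔ ℓ)
    Cyclic = ∃ λ (x₀ : R.Carrier) → ∀ x → ∃ λ (σ : A.Carrier) → σ ∗' x₀ R.≈ x
      where _∗'_ = R._∗_

    OntoProjective : (s₁ s₂ s₃ t₁ t₂ t₃ : Level) →
      Set (lsuc (a ⊔ e ⊔ o) ⊔ r ⊔ ℓ ⊔ p ⊔ lsuc (s₁ ⊔ s₂ ⊔ s₃ ⊔ t₁ ⊔ t₂ ⊔ t₃))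
    OntoProjective s₁ s₂ s₃ t₁ t₂ t₃ =
      (S : Module s₁ s₂ s₃) (T : Module t₁ t₂ t₃) →
      (f : Module.Carrier S → Module.Carrier T) → IsMorphism S T f → Surjective S T f →
      (g : R.Carrier → Module.Carrier T) → IsMorphism R T g →
      ∃ λ (h : R.Carrier → Module.Carrier S) →
        IsMorphism R S h × (∀ x → Module._≈_ T (f (h x)) (g x))

    -- Deductive operators δ : R → ℘(R); "x ∈ δ(y)" is written  δ y x.
    -- Subsets are taken over the setoid R, i.e. closed under ≈.
    _⊆_ : {q : Level} → (R.Carrier → Set q) → (R.Carrier → Set q) → Set (r ⊔ q)
    X ⊆ Y = ∀ x → X x → Y x

    record IsDO {q : Level} (δ : R.Carrier → R.Carrier → Set q) : Set (r ⊔ ℓ ⊔ p ⊔ q) where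
      field
        resp    : ∀ {x x′ y y′} → x R.≈ x′ → y R.≈ y′ → δ y x → δ y′ x′
        incl    : ∀ x → δ x x
        mono    : ∀ {x y} → x R.≤ y → δ x ⊆ δ y
        closed  : ∀ {x y} → δ y x → δ x ⊆ δ y
        +-compat : ∀ {x y} z → δ y x → δ (y R.+ z) (x R.+ z)

    ActionInvariant : {q : Level} → (R.Carrier → R.Carrier → Set q) → Set (a ⊔ r ⊔ q)
    ActionInvariant δ = ∀ σ {x y} → δ y x → δ (σ R.∗ y) (σ R.∗ x)

    -- The module R_δ.  Its elements δ(x) are represented by x ∈ R
    -- (setoid quotient): δ(x) = δ(y) iff δ x ⊆ δ y and δ y ⊆ δ x;
    -- the order is ⊆, and the operations are induced from R.
    module _ {q : Level} (δ : R.Carrier → R.Carrier → Set q)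
             (isDO : IsDO δ) (ai : ActionInvariant δ) where
      private
        module D = IsDO isDO
        module CM = IsCommutativeMonoid R.+-isCommutativeMonoid
        module PO = IsPartialOrder R.isPartialOrder

        _≈δ_ : Rel R.Carrier (r ⊔ q)
        x ≈δ y = (δ x ⊆ δ y) × (δ y ⊆ δ x)

        _≤δ_ : Rel R.Carrier (r ⊔ q)
        x ≤δ y = δ x ⊆ δ y

        ≈⇒⊆ : ∀ {x y} → x R.≈ y → δ x ⊆ δ y
        ≈⇒⊆ x≈y z = D.resp (IsEquivalence.refl CM.isEquivalence) x≈y

        ≈⇒≈δ : ∀ {x y} → x R.≈ y → x ≈δ y
        ≈⇒≈δ x≈y = ≈⇒⊆ x≈y , ≈⇒⊆ (IsEquivalence.sym CM.isEquivalence x≈y)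

        ⊆-trans : ∀ {x y z} → x ≤δ y → y ≤δ z → x ≤δ z
        ⊆-trans p q w = q w ∘ p w

        mem : ∀ {x y} → x ≤δ y → δ y x
        mem {x} p = p x (D.incl x)

        +-lemma : ∀ {x y u v} → x ≤δ y → u ≤δ v → (x R.+ u) ≤δ (y R.+ v)
        +-lemma {x} {y} {u} {v} p q = D.closed step
          where
            s1 : δ (y R.+ u) (x R.+ u)
            s1 = D.+-compat u (mem p)
            s2 : δ (y R.+ v) (y R.+ u)
            s2 = D.resp (CM.comm u y) (CM.comm v y) (D.+-compat y (mem q))
            step : δ (y R.+ v) (x R.+ u)
            step = D.closed s2 _ s1

        ∗-lemma : ∀ {σ π x y} → σ A.≤ π → x ≤δ y → (σ R.∗ x) ≤δ (π R.∗ y)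
        ∗-lemma {σ} {π} {x} {y} σ≤π p =
          D.closed (D.mono (R.∗-mono σ≤π (PO.reflexive (IsEquivalence.refl CM.isEquivalence)))
                           _ (ai σ (mem p)))

        ∗-cong-lemma : ∀ {σ π x y} → σ A.≈ π → x ≤δ y → (σ R.∗ x) ≤δ (π R.∗ y)
        ∗-cong-lemma {σ} {π} {x} {y} σ≈π p =
          ⊆-trans (D.closed (ai σ (mem p)))
                  (≈⇒⊆ (R.∗-cong σ≈π (IsEquivalence.refl CM.isEquivalence)))

        ∗-cong-lemma′ : ∀ {σ π x y} → σ A.≈ π → y ≤δ x → (π R.∗ y) ≤δ (σ R.∗ x)
        ∗-cong-lemma′ {σ} {π} {x} {y} σ≈π p =
          ⊆-trans (D.closed (ai π (mem p)))
                  (≈⇒⊆ (IsEquivalence.sym CM.isEquivalence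
                          (R.∗-cong σ≈π (IsEquivalence.refl CM.isEquivalence))))

        rawδ : RawModule r (r ⊔ q) (r ⊔ q)
        rawδ = record
          { Carrier = R.Carrier ; _≈_ = _≈δ_ ; _≤_ = _≤δ_
          ; _+_ = R._+_ ; 0# = R.0# ; _∗_ = R._∗_ }

        isEqδ : IsEquivalence _≈δ_
        isEqδ = record
          { refl  = (λ _ → id) , (λ _ → id)
          ; sym   = λ { (p , q) → q , p }
          ; trans = λ { (p , q) (p′ , q′) → ⊆-trans p p′ , ⊆-trans q′ q } }

        isModuleδ : IsModule rawδ
        isModuleδ = record
          { isPartialOrder = record
              { isPreorder = record
                  { isEquivalence = isEqδ
                  ; reflexive = proj₁
                  ; trans = ⊆-trans }
              ; antisym = _,_ }
          ; +-isCommutativeMonoid = record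
              { isMonoid = record
                  { isSemigroup = record
                      { isMagma = record
                          { isEquivalence = isEqδ
                          ; ∙-cong = λ { (p , q) (p′ , q′) → +-lemma p p′ , +-lemma q q′ } }
                      ; assoc = λ x y z → ≈⇒≈δ (CM.assoc x y z) }
                  ; identity = (λ x → ≈⇒≈δ (proj₁ CM.identity x))
                             , (λ x → ≈⇒≈δ (proj₂ CM.identity x)) }
              ; comm = λ x y → ≈⇒≈δ (CM.comm x y) }
          ; +-mono = +-lemma
          ; 0-least = λ x → D.mono (R.0-least x)
          ; ∗-cong = λ { σ≈π (p , q) → ∗-cong-lemma σ≈π p , ∗-cong-lemma′ σ≈π q }
          ; ∗-identity = λ x → ≈⇒≈δ (R.∗-identity x)
          ; ∗-assoc = λ σ π x → ≈⇒≈δ (R.∗-assoc σ π x)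
          ; ∗-zero = λ x → ≈⇒≈δ (R.∗-zero x)
          ; ∗-distribˡ = λ σ x y → ≈⇒≈δ (R.∗-distribˡ σ x y)
          ; ∗-distribʳ = λ σ π x → ≈⇒≈δ (R.∗-distribʳ σ π x)
          ; ∗-mono = ∗-lemma }

      _/_ : Module r (r ⊔ q) (r ⊔ q)
      _/_ = record { raw = rawδ ; isModule = isModuleδ }

  module _ {r ℓ p : Level} (R : Module r ℓ p) where
    private module R = Module R
    HasREP : (s₁ s₂ s₃ q₁ q₂ : Level) →
      Set (lsuc (a ⊔ e ⊔ o) ⊔ r ⊔ ℓ ⊔ p ⊔ lsuc (s₁ ⊔ s₂ ⊔ s₃ ⊔ q₁ ⊔ q₂))
    HasREP s₁ s₂ s₃ q₁ q₂ =
      (S : Module s₁ s₂ s₃) →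
      (δ : R.Carrier → R.Carrier → Set q₁) (δ-DO : IsDO R δ) (δ-ai : ActionInvariant R δ) →
      (γ : Module.Carrier S → Module.Carrier S → Set q₂) (γ-DO : IsDO S γ) (γ-ai : ActionInvariant S γ) →
      (Φ : R.Carrier → Module.Carrier S) →
      IsMorphism (_/_ R δ δ-DO δ-ai) (_/_ S γ γ-DO γ-ai) Φ →
      Injective (_/_ R δ δ-DO δ-ai) (_/_ S γ γ-DO γ-ai) Φ →
      OrderReflecting (_/_ R δ δ-DO δ-ai) (_/_ S γ γ-DO γ-ai) Φ →
      ∃ λ (τ : R.Carrier → Module.Carrier S) →
        IsMorphism R S τ ×
        (∀ x → Module._≈_ (_/_ S γ γ-DO γ-ai) (τ x) (Φ x))

record Language (c : Level) : Set (lsuc c) where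
  field
    Con   : Set c
    arity : Con → ℕ
open Language public

data Fm {c : Level} (L : Language c) : Set c where
  var : ℕ → Fm L
  _⟨_⟩ : (k : Con L) → Vec (Fm L) (arity L k) → Fm L

record End {c : Level} (L : Language c) : Set c where
  field
    fun : Fm L → Fm L
    hom : ∀ k (ts : Vec (Fm L) (arity L k)) → fun (k ⟨ ts ⟩) ≡ k ⟨ Vec.map fun ts ⟩
open End public

module _ {c : Level} {L : Language c} where
  idE : End L
  idE = record { fun = id ; hom = λ k ts → P.cong (k ⟨_⟩) (P.sym (VecP.map-id ts)) }

  _∘E_ : End L → End L → End L
  σ ∘E π = record
    { fun = fun σ ∘ fun π
    ; hom = λ k ts → P.trans (P.cong (fun σ) (hom π k ts))
                      (P.trans (hom σ k (Vec.map (fun π) ts))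
                               (P.cong (k ⟨_⟩) (P.sym (VecP.map-∘ (fun σ) (fun π) ts)))) }

  _≈E_ : Rel (End L) c
  σ ≈E π = ∀ φ → fun σ φ ≡ fun π φ

  End-setoid : Setoid c c
  End-setoid = record
    { Carrier = End L ; _≈_ = _≈E_
    ; isEquivalence = record
        { refl = λ φ → P.refl
        ; sym = λ p φ → P.sym (p φ)
        ; trans = λ p q φ → P.trans (p φ) (q φ) } }

-- Finite multisets over X are represented by lists up to permutation;
-- 𝔛 ⩽ 𝔜 iff 𝔜 = 𝔛 ⊎ ℨ for some multiset ℨ; ⊎ is _++_, ∅ is [].

ΣL : {c : Level} (L : Language c) → RawPoSemiring c c c
ΣL L = record
  { Carrier = List (End L)
  ; _≈_ = _↭_
  ; _≤_ = λ xs ys → ∃ λ zs → (xs ++ zs) ↭ ys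
  ; _+_ = _++_
  ; _·_ = cartesianProductWith _∘E_
  ; 0# = []
  ; 1# = idE ∷ [] }
  where open PermS (End-setoid {L = L}) using (_↭_)

MultRaw : {c : Level} (L : Language c) → RawModule (ΣL L) c c c
MultRaw L = record
  { Carrier = List (Fm L)
  ; _≈_ = PermP._↭_
  ; _≤_ = λ Γ Δ → ∃ λ Θ → (Γ ++ Θ) PermP.↭ Δ
  ; _+_ = _++_
  ; 0# = []
  ; _∗_ = λ σs Γ → concatMap (λ σ → map (fun σ) Γ) σs }

Mult : {c : Level} (L : Language c) → IsModule (ΣL L) (MultRaw L) → Module (ΣL L) c c c
Mult L isMod = record { raw = MultRaw L ; isModule = isMod }

module Submission where

-- The multiset Γ = [φ₁, …, φₙ] is [c_φ₁, …, c_φₙ] ∗ [var 0], where c_φ is the substitution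
-- sending every variable to φ.  The map ι : Γ ↦ [c_φ₁, …, c_φₙ] is additive and monotone, and
-- it is equivariant, ι (σs ∗ Γ) = σs · ι Γ, because σ ∘ c_φ = c_σ(φ).  So Mult_L, generated by
-- [var 0], is a retract of the regular Σ_L-module: it is cyclic, and a morphism g out of it
-- lifts along an onto morphism f by Γ ↦ ι Γ ∗ s₀ for any s₀ with f s₀ = g [var 0].  The REP is
-- onto-projectivity applied to the quotient morphism S → S_γ.

open import Defs
open import Level using (Level; _⊔_)
open import Data.Product using (Σ; _×_; ∃; _,_; proj₁; proj₂)
open import Data.Nat using (ℕ)
open import Data.Nat.Properties using (m+1+n≢m)
open import Data.List using (List; []; _∷_; _++_; [_]; map; concatMap; length)
open import Data.List.Properties
  using (map-++; map-id; map-∘; map-cong; ++-identityʳ; concatMap-++; concatMap-cong; concatMap-map; map-concatMap; length-++)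
open import Data.Vec as Vec using (Vec)
open import Function using (id; _∘_)
open import Relation.Nullary using (¬_; contradiction)
open import Relation.Binary using (Rel; Setoid; IsPartialOrder)
open import Relation.Binary.PropositionalEquality as ≡ using (_≡_; refl)
open import Algebra using (CommutativeMonoid)
import Algebra.Properties.CommutativeSemigroup as CommutativeSemigroupProperties
import Data.List.Relation.Binary.Equality.Setoid as SetoidEquality
import Data.List.Relation.Binary.Permutation.Setoid as SetoidPermutation
import Data.List.Relation.Binary.Permutation.Setoid.Properties as SetoidPermutationProperties
open import Data.List.Relation.Binary.Permutation.Propositional
  using (_↭_; ↭-isEquivalence; ↭-refl; ↭-reflexive; ↭-sym; ↭-trans; ↭-setoid; ↭⇒↭ₛ′; module PermutationReasoning)
import Data.List.Relation.Binary.Permutation.Propositional.Properties as Perm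

module _ {a e o : Level} {A : RawPoSemiring a e o} where
  private module A = RawPoSemiring A

  module ModuleEq {r ℓ p : Level} (R : Module A r ℓ p) where
    open Module R public
    open IsPartialOrder isPartialOrder public
      using (isEquivalence; module Eq) renaming (refl to ≤-refl)

    setoid : Setoid r ℓ
    setoid = record { isEquivalence = isEquivalence }

  module _ {r ℓ p : Level} (R : Module A r ℓ p) where
    private module R = Module R

    -- ι exhibits R as a retract of the regular module A along σ ↦ σ ∗ x₀.
    record GeneratorSection (x₀ : R.Carrier) : Set (a ⊔ e ⊔ o ⊔ r ⊔ ℓ ⊔ p) where
      field
        ι         : R.Carrier → A.Carrier
        ι-cong    : ∀ {x y} → x R.≈ y → ι x A.≈ ι y
        ι-mono    : ∀ {x y} → x R.≤ y → ι x A.≤ ι y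
        ι-+       : ∀ x y → ι (x R.+ y) A.≈ ι x A.+ ι y
        ι-0       : ι R.0# A.≈ A.0#
        ι-∗       : ∀ σ x → ι (σ R.∗ x) A.≈ σ A.· ι x
        ι-section : ∀ x → ι x R.∗ x₀ R.≈ x

  module _ {r₁ ℓ₁ p₁ r₂ ℓ₂ p₂ r₃ ℓ₃ p₃ : Level}
           {R : Module A r₁ ℓ₁ p₁} {S : Module A r₂ ℓ₂ p₂} {T : Module A r₃ ℓ₃ p₃} where

    ∘-isMorphism : ∀ {f g} → IsMorphism A R S f → IsMorphism A S T g → IsMorphism A R T (g ∘ f)
    ∘-isMorphism {f} {g} f-hom g-hom = record
      { cong  = g.cong ∘ f.cong
      ; mono  = g.mono ∘ f.mono
      ; +-hom = λ x y → T.trans (g.cong (f.+-hom x y)) (g.+-hom (f x) (f y))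
      ; 0-hom = T.trans (g.cong f.0-hom) g.0-hom
      ; ∗-hom = λ σ x → T.trans (g.cong (f.∗-hom σ x)) (g.∗-hom σ (f x))
      }
      where
        module f = IsMorphism f-hom
        module g = IsMorphism g-hom
        module T = ModuleEq.Eq T

  module _ {r ℓ p q : Level} (R : Module A r ℓ p) {δ : Module.Carrier R → Module.Carrier R → Set q}
           (δ-DO : IsDO A R δ) (δ-ai : ActionInvariant A R δ) where
    private
      module R = ModuleEq R
      module δ = IsDO δ-DO
      R/δ : Module A r (r ⊔ q) (r ⊔ q)
      R/δ = _/_ A R δ δ-DO δ-ai
      module R/δ = ModuleEq R/δ

    quotient-isMorphism : IsMorphism A R R/δ id
    quotient-isMorphism = record
      { cong  = λ x≈y → (λ _ → δ.resp R.Eq.refl x≈y) , (λ _ → δ.resp R.Eq.refl (R.Eq.sym x≈y))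
      ; mono  = δ.mono
      ; +-hom = λ _ _ → R/δ.Eq.refl
      ; 0-hom = R/δ.Eq.refl
      ; ∗-hom = λ _ _ → R/δ.Eq.refl
      }

    quotient-surjective : Surjective A R R/δ id
    quotient-surjective x = x , R/δ.Eq.refl

  module _ {r ℓ p : Level} {R : Module A r ℓ p} where
    private module R = ModuleEq R

    section⇒cyclic : ∀ {x₀} → GeneratorSection R x₀ → Cyclic A R
    section⇒cyclic {x₀} s = x₀ , λ x → ι x , ι-section x
      where open GeneratorSection s

    section⇒ontoProjective : ∀ {x₀} → GeneratorSection R x₀ →
                             ∀ {s₁ s₂ s₃ t₁ t₂ t₃} → OntoProjective A R s₁ s₂ s₃ t₁ t₂ t₃
    section⇒ontoProjective {x₀} s S T f f-hom f-onto g g-hom = h , h-hom , f∘h≈g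
      where
        open GeneratorSection s
        module S = ModuleEq S
        module T = ModuleEq T
        module f = IsMorphism f-hom
        module g = IsMorphism g-hom

        s₀ : S.Carrier
        s₀ = proj₁ (f-onto (g x₀))

        h : R.Carrier → S.Carrier
        h x = ι x S.∗ s₀

        ι-refl : ∀ {x} → ι x A.≈ ι x
        ι-refl = ι-cong R.Eq.refl

        h-hom : IsMorphism A R S h
        h-hom = record
          { cong  = λ x≈y → S.∗-cong (ι-cong x≈y) S.Eq.refl
          ; mono  = λ x≤y → S.∗-mono (ι-mono x≤y) S.≤-refl
          ; +-hom = λ x y → S.Eq.trans (S.∗-cong (ι-+ x y) S.Eq.refl) (S.∗-distribʳ (ι x) (ι y) s₀)
          ; 0-hom = S.Eq.trans (S.∗-cong ι-0 S.Eq.refl) (S.∗-zero s₀)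
          ; ∗-hom = λ σ x → S.Eq.trans (S.∗-cong (ι-∗ σ x) S.Eq.refl) (S.∗-assoc σ (ι x) s₀)
          }

        f∘h≈g : ∀ x → f (h x) T.≈ g x
        f∘h≈g x = begin
          f (ι x S.∗ s₀)  ≈⟨ f.∗-hom (ι x) s₀ ⟩
          ι x T.∗ f s₀    ≈⟨ T.∗-cong ι-refl (proj₂ (f-onto (g x₀))) ⟩
          ι x T.∗ g x₀    ≈⟨ g.∗-hom (ι x) x₀ ⟨
          g (ι x R.∗ x₀)  ≈⟨ g.cong (ι-section x) ⟩
          g x             ∎
          where open import Relation.Binary.Reasoning.Setoid T.setoid

    ontoProjective⇒hasREP : ∀ {u₁ u₂ u₃ q₁ q₂} →
      OntoProjective A R u₁ u₂ u₃ u₁ (u₁ ⊔ q₂) (u₁ ⊔ q₂) → HasREP A R u₁ u₂ u₃ q₁ q₂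
    ontoProjective⇒hasREP projective S _ δ-DO δ-ai γ γ-DO γ-ai Φ Φ-hom _ _ =
      projective S (_/_ A S γ γ-DO γ-ai) id (quotient-isMorphism S γ-DO γ-ai)
                 (quotient-surjective S γ-DO γ-ai)
                 Φ (∘-isMorphism (quotient-isMorphism R δ-DO δ-ai) Φ-hom)

module _ {a : Level} {X : Set a} where
  open CommutativeSemigroupProperties
    (CommutativeMonoid.commutativeSemigroup (Perm.++-commutativeMonoid {A = X})) using (interchange)

  infix 4 _⊑_
  _⊑_ : Rel (List X) a
  Γ ⊑ Δ = ∃ λ Θ → Γ ++ Θ ↭ Δ

  ⊑-reflexive : ∀ {Γ Δ} → Γ ↭ Δ → Γ ⊑ Δ
  ⊑-reflexive {Γ} Γ↭Δ = [] , ↭-trans (Perm.++-identityʳ Γ) Γ↭Δ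

  ⊑-trans : ∀ {Γ Δ Ε} → Γ ⊑ Δ → Δ ⊑ Ε → Γ ⊑ Ε
  ⊑-trans {Γ} (Θ , p) (Θ′ , q) =
    Θ ++ Θ′ , ↭-trans (↭-sym (Perm.++-assoc Γ Θ Θ′)) (↭-trans (Perm.++⁺ʳ Θ′ p) q)

  ¬xs++y∷ys↭xs : ∀ (xs : List X) {y ys} → ¬ (xs ++ y ∷ ys ↭ xs)
  ¬xs++y∷ys↭xs xs p = m+1+n≢m (length xs) (≡.trans (≡.sym (length-++ xs)) (Perm.↭-length p))

  ⊑-antisym : ∀ {Γ Δ} → Γ ⊑ Δ → Δ ⊑ Γ → Γ ↭ Δ
  ⊑-antisym {Γ} ([] , p)    _   = ↭-trans (↭-sym (Perm.++-identityʳ Γ)) p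
  ⊑-antisym {Γ} (t ∷ Θ , p) Δ⊑Γ = contradiction (proj₂ (⊑-trans (t ∷ Θ , p) Δ⊑Γ)) (¬xs++y∷ys↭xs Γ)

  ⊑-isPartialOrder : IsPartialOrder _↭_ _⊑_
  ⊑-isPartialOrder = record
    { isPreorder = record
        { isEquivalence = ↭-isEquivalence
        ; reflexive     = ⊑-reflexive
        ; trans         = ⊑-trans
        }
    ; antisym = ⊑-antisym
    }

  ++-mono-⊑ : ∀ {Γ Δ Γ′ Δ′} → Γ ⊑ Δ → Γ′ ⊑ Δ′ → Γ ++ Γ′ ⊑ Δ ++ Δ′
  ++-mono-⊑ {Γ} {_} {Γ′} (Θ , p) (Θ′ , q) = Θ ++ Θ′ , ↭-trans (interchange Γ Γ′ Θ Θ′) (Perm.++⁺ p q)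

module _ {c : Level} {L : Language c} where
  private
    module ΣL = RawPoSemiring (ΣL L)
    module ↭E = SetoidPermutation (End-setoid {L = L})
    open SetoidEquality (End-setoid {L = L})
      using (_≋_; _∷_; []; ≋-reflexive; ≋-trans) renaming (++⁺ to ≋-++⁺)

    F : Set c
    F = Fm L

  mutual
    substitute : (ℕ → F) → F → F
    substitute s (var n)    = s n
    substitute s (k ⟨ ts ⟩) = k ⟨ substituteVec s ts ⟩

    substituteVec : ∀ {n} → (ℕ → F) → Vec F n → Vec F n
    substituteVec s Vec.[]       = Vec.[]
    substituteVec s (t Vec.∷ ts) = substitute s t Vec.∷ substituteVec s ts

  substituteVec≡map : ∀ {n} s (ts : Vec F n) → substituteVec s ts ≡ Vec.map (substitute s) ts
  substituteVec≡map s Vec.[]       = refl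
  substituteVec≡map s (t Vec.∷ ts) = ≡.cong (substitute s t Vec.∷_) (substituteVec≡map s ts)

  substitution : (ℕ → F) → End L
  substitution s = record
    { fun = substitute s
    ; hom = λ k ts → ≡.cong (k ⟨_⟩) (substituteVec≡map s ts)
    }

  constSubst : F → End L
  constSubst φ = substitution (λ _ → φ)

  module _ {σ π : End L} (agree : ∀ n → fun σ (var n) ≡ fun π (var n)) where
    mutual
      End-ext : σ ≈E π
      End-ext (var n)    = agree n
      End-ext (k ⟨ ts ⟩) = begin
        fun σ (k ⟨ ts ⟩)             ≡⟨ hom σ k ts ⟩
        k ⟨ Vec.map (fun σ) ts ⟩     ≡⟨ ≡.cong (k ⟨_⟩) (End-extVec ts) ⟩
        k ⟨ Vec.map (fun π) ts ⟩     ≡⟨ hom π k ts ⟨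
        fun π (k ⟨ ts ⟩)             ∎
        where open ≡.≡-Reasoning

      End-extVec : ∀ {n} (ts : Vec F n) → Vec.map (fun σ) ts ≡ Vec.map (fun π) ts
      End-extVec Vec.[]       = refl
      End-extVec (t Vec.∷ ts) = ≡.cong₂ Vec._∷_ (End-ext t) (End-extVec ts)

  constSubst-∘ : ∀ σ φ → constSubst (fun σ φ) ≈E (σ ∘E constSubst φ)
  constSubst-∘ σ φ = End-ext {constSubst (fun σ φ)} {σ ∘E constSubst φ} (λ _ → refl)

  open RawModule (MultRaw L) using (_∗_)
  open CommutativeSemigroupProperties
    (CommutativeMonoid.commutativeSemigroup (Perm.++-commutativeMonoid {A = F})) using (interchange)

  ∗-congʳ : ∀ σs {Γ Δ} → Γ ↭ Δ → σs ∗ Γ ↭ σs ∗ Δ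
  ∗-congʳ []       Γ↭Δ = ↭-refl
  ∗-congʳ (σ ∷ σs) Γ↭Δ = Perm.++⁺ (Perm.map⁺ (fun σ) Γ↭Δ) (∗-congʳ σs Γ↭Δ)

  -- σs ∗ Γ folds the commutative monoid (List F, ++, []) over a list indexed by σs.
  ∗-congˡ : ∀ {σs πs} → σs ΣL.≈ πs → ∀ Γ → σs ∗ Γ ↭ πs ∗ Γ
  ∗-congˡ σs≈πs Γ =
    foldr-commMonoid Perm.++-isCommutativeMonoid
      (map⁺ ↭-setoid (λ σ≈π → ↭-reflexive (map-cong σ≈π Γ)) σs≈πs)
    where
      open SetoidPermutationProperties (End-setoid {L = L}) using (map⁺)
      open SetoidPermutationProperties (↭-setoid {A = F}) using (foldr-commMonoid)

  ∗-distribˡ : ∀ σs Γ Δ → σs ∗ (Γ ++ Δ) ↭ σs ∗ Γ ++ σs ∗ Δ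
  ∗-distribˡ []       Γ Δ = ↭-refl
  ∗-distribˡ (σ ∷ σs) Γ Δ = begin
    map (fun σ) (Γ ++ Δ) ++ σs ∗ (Γ ++ Δ)
      ↭⟨ Perm.++⁺ (↭-reflexive (map-++ (fun σ) Γ Δ)) (∗-distribˡ σs Γ Δ) ⟩
    (map (fun σ) Γ ++ map (fun σ) Δ) ++ (σs ∗ Γ ++ σs ∗ Δ)
      ↭⟨ interchange (map (fun σ) Γ) _ _ _ ⟩
    (map (fun σ) Γ ++ σs ∗ Γ) ++ (map (fun σ) Δ ++ σs ∗ Δ)
      ∎
    where open PermutationReasoning

  ∗-distribʳ : ∀ σs πs Γ → (σs ++ πs) ∗ Γ ≡ σs ∗ Γ ++ πs ∗ Γ
  ∗-distribʳ σs πs Γ = concatMap-++ (λ σ → map (fun σ) Γ) σs πs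

  map-∘E-∗ : ∀ σ πs Γ → map (σ ∘E_) πs ∗ Γ ≡ map (fun σ) (πs ∗ Γ)
  map-∘E-∗ σ πs Γ = begin
    map (σ ∘E_) πs ∗ Γ                               ≡⟨ concatMap-map _ (σ ∘E_) πs ⟩
    concatMap (λ π → map (fun σ ∘ fun π) Γ) πs       ≡⟨ concatMap-cong (λ _ → map-∘ Γ) πs ⟩
    concatMap (λ π → map (fun σ) (map (fun π) Γ)) πs ≡⟨ map-concatMap (fun σ) _ πs ⟨
    map (fun σ) (πs ∗ Γ)                             ∎
    where open ≡.≡-Reasoning

  ∗-assoc : ∀ σs πs Γ → (σs ΣL.· πs) ∗ Γ ≡ σs ∗ (πs ∗ Γ)
  ∗-assoc []       πs Γ = refl
  ∗-assoc (σ ∷ σs) πs Γ = begin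
    (map (σ ∘E_) πs ++ σs ΣL.· πs) ∗ Γ         ≡⟨ ∗-distribʳ (map (σ ∘E_) πs) _ Γ ⟩
    map (σ ∘E_) πs ∗ Γ ++ (σs ΣL.· πs) ∗ Γ     ≡⟨ ≡.cong₂ _++_ (map-∘E-∗ σ πs Γ) (∗-assoc σs πs Γ) ⟩
    map (fun σ) (πs ∗ Γ) ++ σs ∗ (πs ∗ Γ)      ∎
    where open ≡.≡-Reasoning

  ∗-monoʳ : ∀ σs {Γ Δ} → Γ ⊑ Δ → σs ∗ Γ ⊑ σs ∗ Δ
  ∗-monoʳ σs {Γ} (Θ , Γ++Θ↭Δ) = σs ∗ Θ , ↭-trans (↭-sym (∗-distribˡ σs Γ Θ)) (∗-congʳ σs Γ++Θ↭Δ)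

  ∗-monoˡ : ∀ {σs πs} → σs ΣL.≤ πs → ∀ Γ → σs ∗ Γ ⊑ πs ∗ Γ
  ∗-monoˡ {σs} (ζs , σs++ζs≈πs) Γ =
    ζs ∗ Γ , ↭-trans (↭-reflexive (≡.sym (∗-distribʳ σs ζs Γ))) (∗-congˡ σs++ζs≈πs Γ)

  Mult-isModule : IsModule (ΣL L) (MultRaw L)
  Mult-isModule = record
    { isPartialOrder        = ⊑-isPartialOrder
    ; +-isCommutativeMonoid = Perm.++-isCommutativeMonoid
    ; +-mono                = ++-mono-⊑
    ; 0-least               = λ Γ → Γ , ↭-refl
    ; ∗-cong                = λ {σs} {_} {_} {Δ} σs≈πs Γ↭Δ → ↭-trans (∗-congʳ σs Γ↭Δ) (∗-congˡ σs≈πs Δ)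
    ; ∗-identity            = λ Γ → ↭-reflexive (≡.trans (++-identityʳ (map id Γ)) (map-id Γ))
    ; ∗-assoc               = λ σs πs Γ → ↭-reflexive (∗-assoc σs πs Γ)
    ; ∗-zero                = λ _ → ↭-refl
    ; ∗-distribˡ            = ∗-distribˡ
    ; ∗-distribʳ            = λ σs πs Γ → ↭-reflexive (∗-distribʳ σs πs Γ)
    ; ∗-mono                = λ {_} {πs} {Γ} σs≤πs Γ⊑Δ → ⊑-trans (∗-monoˡ σs≤πs Γ) (∗-monoʳ πs Γ⊑Δ)
    }

  ι : List F → List (End L)
  ι = map constSubst

  ι-map : ∀ σ Γ → ι (map (fun σ) Γ) ≋ map (σ ∘E_) (ι Γ)
  ι-map σ []      = []
  ι-map σ (φ ∷ Γ) = constSubst-∘ σ φ ∷ ι-map σ Γ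

  ι-∗ : ∀ σs Γ → ι (σs ∗ Γ) ≋ σs ΣL.· ι Γ
  ι-∗ []       Γ = []
  ι-∗ (σ ∷ σs) Γ = ≋-trans (≋-reflexive (map-++ constSubst (map (fun σ) Γ) (σs ∗ Γ)))
                           (≋-++⁺ (ι-map σ Γ) (ι-∗ σs Γ))

  ι-∗-var0 : ∀ Γ → ι Γ ∗ [ var 0 ] ≡ Γ
  ι-∗-var0 []      = refl
  ι-∗-var0 (φ ∷ Γ) = ≡.cong (φ ∷_) (ι-∗-var0 Γ)

  ι-cong : ∀ {Γ Δ} → Γ ↭ Δ → ι Γ ΣL.≈ ι Δ
  ι-cong Γ↭Δ = ↭⇒↭ₛ′ (Setoid.isEquivalence End-setoid) (Perm.map⁺ constSubst Γ↭Δ)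

  ι-++ : ∀ Γ Δ → ι (Γ ++ Δ) ΣL.≈ ι Γ ++ ι Δ
  ι-++ Γ Δ = ↭E.↭-reflexive (map-++ constSubst Γ Δ)

  Mult-generatorSection : GeneratorSection (Mult L Mult-isModule) [ var 0 ]
  Mult-generatorSection = record
    { ι         = ι
    ; ι-cong    = ι-cong
    ; ι-mono    = λ { {Γ} (Θ , Γ++Θ↭Δ) → ι Θ , ↭E.↭-trans (↭E.↭-sym (ι-++ Γ Θ)) (ι-cong Γ++Θ↭Δ) }
    ; ι-+       = ι-++
    ; ι-0       = ↭E.↭-refl
    ; ι-∗       = λ σs Γ → ↭E.↭-reflexive-≋ (ι-∗ σs Γ)
    ; ι-section = λ Γ → ↭-reflexive (ι-∗-var0 Γ)
    }

theorem4p18 : {c : Level} (L : Language c) (s₁ s₂ s₃ t₁ t₂ t₃ u₁ u₂ u₃ q₁ q₂ : Level) →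
    Σ (IsModule (ΣL L) (MultRaw L)) λ isMod →
      Cyclic (ΣL L) (Mult L isMod)
      × OntoProjective (ΣL L) (Mult L isMod) s₁ s₂ s₃ t₁ t₂ t₃
      × HasREP (ΣL L) (Mult L isMod) u₁ u₂ u₃ q₁ q₂
theorem4p18 L _ _ _ _ _ _ _ _ _ _ _ =
  Mult-isModule , section⇒cyclic Mult-generatorSection
                , section⇒ontoProjective Mult-generatorSection
                , ontoProjective⇒hasREP (section⇒ontoProjective Mult-generatorSection)
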